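{- Let $n,k,s,q$ be integers with $s\ge 2$, $k\le q\le k+s-2$ and $n>q$. Then $m(n,k,s,q)=\binom{q}{k}$.
   Context: A family $\mathcal F\subset\binom{[n]}{k}$ (the $k$-subsets of $[n]=\{1,\ldots,n\}$) has property $U(s,q)$ if $|F_1\cup\ldots\cup F_s|\le q$ for all choices of $F_1,\ldots,F_s\in\mathcal F$ (not necessarily distinct). $m(n,k,s,q)$ denotes the maximum of $|\mathcal F|$ over all $\mathcal F\subset\binom{[n]}{k}$ having property $U(s,q)$. -}

module Defs where

open import Data.Nat using (ℕ; _≤_)
open import Data.Fin using (Fin)
open import Data.Fin.Subset using (Subset; ⋃; ∣_∣)
open import Data.List using (List; length)
open import Data.List.Relation.Unary.All using (All)
open import Data.List.Relation.Unary.Unique.Propositional using (Unique)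
open import Data.List.Membership.Propositional using (_∈_)
open import Data.Product using (_×_; Σ)
open import Data.Vec.Functional using (toList)
open import Relation.Binary.PropositionalEquality using (_≡_)

-- A family F ⊂ binom([n], k): a duplicate-free list of subsets of Fin n,
-- each of cardinality k.
IsKFamily : (n k : ℕ) → List (Subset n) → Set
IsKFamily n k 𝓕 = Unique 𝓕 × All (λ F → ∣ F ∣ ≡ k) 𝓕

-- Property U(s,q): for all F₁,…,F_s ∈ 𝓕 (not necessarily distinct),
-- |F₁ ∪ … ∪ F_s| ≤ q.
PropU : {n : ℕ} (s q : ℕ) → List (Subset n) → Set
PropU {n} s q 𝓕 =
  (F : Fin s → Subset n) → (∀ i → F i ∈ 𝓕) → ∣ ⋃ (toList F) ∣ ≤ q

IsMaxU : (n k s q M : ℕ) → Set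
IsMaxU n k s q M =
  Σ (List (Subset n)) (λ 𝓕 → IsKFamily n k 𝓕 × PropU s q 𝓕 × length 𝓕 ≡ M)
  × ((𝓕 : List (Subset n)) → IsKFamily n k 𝓕 → PropU s q 𝓕 → length 𝓕 ≤ M)

-- Lower bound: all k-subsets of a fixed q-subset of [n] form a family
-- with U(s,q) (every union stays inside that q-set) of size q C k.
--
-- Upper bound: let 𝓕 be a k-uniform family with U(s,q).  Greedily pick
-- members F₀, F₁, … of 𝓕, each one not contained in the union of the
-- previous ones, so that every pick enlarges the union by at least one
-- point.  If the first s picks all exist, their union has at least
-- k + s − 1 > q points, contradicting U(s,q).  So at most s picks cover
-- all of 𝓕, and hence |⋃ 𝓕| ≤ q.  Then 𝓕 is a set of k-subsets of a set
-- with at most q points, so |𝓕| ≤ q C k.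
module Submission where

open import Defs
open import Data.Nat using (ℕ; zero; suc; _≤_; _<_; _+_; _∸_; z≤n; s≤s)
open import Data.Nat.Properties
open import Data.Nat.Combinatorics using (_C_; nCk+nC[k+1]≡[n+1]C[k+1])
open import Data.Fin as Fin using (Fin; toℕ; inject≤)
open import Data.Fin.Properties using (pigeonhole; toℕ-inject≤)
open import Data.Fin.Subset using (Subset; ⋃; ∣_∣; _∪_; _⊆_; _⊈_; inside; outside)
open import Data.Fin.Subset.Properties
  using (p⊆q⇒∣p∣≤∣q∣; p⊂q⇒∣p∣<∣q∣; _⊂?_; _∈?_; _⊆?_; p⊆p∪q; q⊆p∪q; x∈p∪q⁻;
         ⊥⊆; ∣⊥∣≡0; ⊆-trans; drop-∷-⊆; out⊆; in⊆in)
open import Data.List using (List; []; _∷_; [_]; length; map; _++_; lookup)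
open import Data.List.Properties using (length-map; length-++)
open import Data.List.Relation.Unary.All as All using (All; []; _∷_; all?)
import Data.List.Relation.Unary.All.Properties as All
import Data.List.Relation.Unary.Any as Any
open import Data.List.Relation.Unary.Any using (here; there)
open import Data.List.Relation.Unary.Any.Properties using (lookup-index)
open import Data.List.Relation.Unary.AllPairs using ([]; _∷_)
open import Data.List.Relation.Unary.Unique.Propositional using (Unique)
import Data.List.Relation.Unary.Unique.Propositional.Properties as Unique
open import Data.List.Membership.Propositional using (_∈_; find)
open import Data.List.Membership.Propositional.Properties
  using (∈-lookup; ∈-map⁺; ∈-map⁻; ∈-++⁺ˡ; ∈-++⁺ʳ; ∈-tabulate⁺)
open import Data.Empty using (⊥-elim)
open import Data.Product using (_×_; _,_; proj₁; proj₂; ∃; uncurry)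
open import Data.Sum using (_⊎_; inj₁; inj₂; [_,_]′)
open import Data.Vec using ([]; _∷_)
open import Data.Vec.Properties using (∷-injectiveʳ)
open import Data.Vec.Functional using (toList)
open import Relation.Binary.PropositionalEquality using (_≡_; _≢_; refl; sym; trans; cong; cong₂; subst; module ≡-Reasoning)
open import Relation.Nullary using (¬_; yes; no; contradiction)
open import Relation.Nullary.Decidable using (decidable-stable)

private
  variable
    n k s q : ℕ

-- Pascal's rule makes  n C k  non-decreasing in n.
C-step : ∀ n k → n C k ≤ suc n C k
C-step n zero    = ≤-refl
C-step n (suc k) = begin
  n C suc k             ≤⟨ m≤n+m (n C suc k) (n C k) ⟩
  n C k + n C suc k     ≡⟨ nCk+nC[k+1]≡[n+1]C[k+1] n k ⟩
  suc n C suc k         ∎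
  where open ≤-Reasoning

C-monoˡ : ∀ k {m n} → m ≤ n → m C k ≤ n C k
C-monoˡ k {n = zero} z≤n = ≤-refl
C-monoˡ k {m} {suc n} m≤1+n with m≤n⇒m<n∨m≡n m≤1+n
... | inj₁ (s≤s m≤n) = ≤-trans (C-monoˡ k m≤n) (C-step n k)
... | inj₂ refl      = ≤-refl

module _ {a} {A : Set a} where

  unique-lookup : ∀ {xs : List A} → Unique xs →
                  ∀ {i j} → i Fin.< j → lookup xs i ≢ lookup xs j
  unique-lookup (x≢ ∷ _) {Fin.zero}  {Fin.suc j} _         = All.lookup x≢ (∈-lookup j)
  unique-lookup (_ ∷ u)  {Fin.suc i} {Fin.suc j} (s≤s i<j) = unique-lookup u i<j

  unique⇒length≤ : ∀ {xs ys : List A} → Unique xs → All (_∈ ys) xs →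
                   length xs ≤ length ys
  unique⇒length≤ {xs} {ys} u xs⊆ys with length xs ≤? length ys
  ... | yes fits = fits
  ... | no tooLong =
    let i , j , i<j , samePosition = pigeonhole (≰⇒> tooLong) position
    in  contradiction (trans (entry i) (trans (cong (lookup ys) samePosition) (sym (entry j))))
                      (unique-lookup u i<j)
    where
      position : Fin (length xs) → Fin (length ys)
      position i = Any.index (All.lookup xs⊆ys (∈-lookup i))

      entry : ∀ i → lookup xs i ≡ lookup ys (position i)
      entry i = lookup-index (All.lookup xs⊆ys (∈-lookup i))

  lookupOr : A → List A → ℕ → A
  lookupOr d []       _       = d
  lookupOr d (x ∷ xs) zero    = x
  lookupOr d (x ∷ xs) (suc j) = lookupOr d xs j

  lookupOr-lookup : ∀ d (xs : List A) i → lookupOr d xs (toℕ i) ≡ lookup xs i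
  lookupOr-lookup d (x ∷ xs) Fin.zero    = refl
  lookupOr-lookup d (x ∷ xs) (Fin.suc i) = lookupOr-lookup d xs i

  lookupOr-All : ∀ {p} {P : A → Set p} {d xs} → P d → All P xs → ∀ j → P (lookupOr d xs j)
  lookupOr-All Pd []         _       = Pd
  lookupOr-All Pd (Px ∷ _)   zero    = Px
  lookupOr-All Pd (_ ∷ Pxs)  (suc j) = lookupOr-All Pd Pxs j

kSubsets : Subset n → ℕ → List (Subset n)
kSubsets []            zero    = [ [] ]
kSubsets []            (suc k) = []
kSubsets (outside ∷ U) k       = map (outside ∷_) (kSubsets U k)
kSubsets (inside ∷ U)  zero    = map (outside ∷_) (kSubsets U zero)
kSubsets (inside ∷ U)  (suc k) =
  map (inside ∷_) (kSubsets U k) ++ map (outside ∷_) (kSubsets U (suc k))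

length-kSubsets : ∀ (U : Subset n) k → length (kSubsets U k) ≡ ∣ U ∣ C k
length-kSubsets []            zero    = refl
length-kSubsets []            (suc k) = refl
length-kSubsets (outside ∷ U) k       = trans (length-map _ (kSubsets U k)) (length-kSubsets U k)
length-kSubsets (inside ∷ U)  zero    = trans (length-map _ (kSubsets U zero)) (length-kSubsets U zero)
length-kSubsets (inside ∷ U)  (suc k) = begin
  length (map (inside ∷_) (kSubsets U k) ++ map (outside ∷_) (kSubsets U (suc k)))
    ≡⟨ length-++ (map (inside ∷_) (kSubsets U k)) ⟩
  length (map (inside ∷_) (kSubsets U k)) + length (map (outside ∷_) (kSubsets U (suc k)))
    ≡⟨ cong₂ _+_ (length-map _ (kSubsets U k)) (length-map _ (kSubsets U (suc k))) ⟩
  length (kSubsets U k) + length (kSubsets U (suc k))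
    ≡⟨ cong₂ _+_ (length-kSubsets U k) (length-kSubsets U (suc k)) ⟩
  ∣ U ∣ C k + ∣ U ∣ C suc k
    ≡⟨ nCk+nC[k+1]≡[n+1]C[k+1] ∣ U ∣ k ⟩
  suc ∣ U ∣ C suc k ∎
  where open ≡-Reasoning

kSubsets-unique : ∀ (U : Subset n) k → Unique (kSubsets U k)
kSubsets-unique []            zero    = [] ∷ []
kSubsets-unique []            (suc k) = []
kSubsets-unique (outside ∷ U) k       = Unique.map⁺ ∷-injectiveʳ (kSubsets-unique U k)
kSubsets-unique (inside ∷ U)  zero    = Unique.map⁺ ∷-injectiveʳ (kSubsets-unique U zero)
kSubsets-unique (inside ∷ U)  (suc k) =
  Unique.++⁺ (Unique.map⁺ ∷-injectiveʳ (kSubsets-unique U k))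
             (Unique.map⁺ ∷-injectiveʳ (kSubsets-unique U (suc k)))
             headsDiffer
  where
    headsDiffer : ∀ {F} → ¬ (F ∈ map (inside ∷_) (kSubsets U k) × F ∈ map (outside ∷_) (kSubsets U (suc k)))
    headsDiffer (p , q) with ∈-map⁻ (inside ∷_) p | ∈-map⁻ (outside ∷_) q
    ... | _ , _ , refl | _ , _ , ()

outside-kSubset : ∀ {b} {F U : Subset n} → F ⊆ U × ∣ F ∣ ≡ k → outside ∷ F ⊆ b ∷ U × ∣ outside ∷ F ∣ ≡ k
outside-kSubset (F⊆U , ∣F∣≡k) = out⊆ F⊆U , ∣F∣≡k

inside-kSubset : ∀ {F U : Subset n} → F ⊆ U × ∣ F ∣ ≡ k → inside ∷ F ⊆ inside ∷ U × ∣ inside ∷ F ∣ ≡ suc k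
inside-kSubset (F⊆U , ∣F∣≡k) = in⊆in F⊆U , cong suc ∣F∣≡k

kSubsets-sound : ∀ (U : Subset n) k → All (λ F → F ⊆ U × ∣ F ∣ ≡ k) (kSubsets U k)
kSubsets-sound []            zero    = ((λ x∈F → x∈F) , refl) ∷ []
kSubsets-sound []            (suc k) = []
kSubsets-sound (outside ∷ U) k       = All.map⁺ (All.map outside-kSubset (kSubsets-sound U k))
kSubsets-sound (inside ∷ U)  zero    = All.map⁺ (All.map outside-kSubset (kSubsets-sound U zero))
kSubsets-sound (inside ∷ U)  (suc k) = All.++⁺
  (All.map⁺ (All.map inside-kSubset (kSubsets-sound U k)))
  (All.map⁺ (All.map outside-kSubset (kSubsets-sound U (suc k))))

kSubsets-complete : ∀ {F U : Subset n} → F ⊆ U → ∣ F ∣ ≡ k → F ∈ kSubsets U k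
kSubsets-complete {F = []}          {[]}          _    refl = here refl
kSubsets-complete {F = inside ∷ F}  {outside ∷ U} F⊆U  _    = contradiction (F⊆U Data.Vec.here) λ ()
kSubsets-complete {F = outside ∷ F} {outside ∷ U} F⊆U  refl =
  ∈-map⁺ (outside ∷_) (kSubsets-complete (drop-∷-⊆ F⊆U) refl)
kSubsets-complete {F = inside ∷ F}  {inside ∷ U}  F⊆U  refl =
  ∈-++⁺ˡ (∈-map⁺ (inside ∷_) (kSubsets-complete (drop-∷-⊆ F⊆U) refl))
kSubsets-complete {k = zero}  {outside ∷ F} {inside ∷ U} F⊆U ∣F∣≡0 =
  ∈-map⁺ (outside ∷_) (kSubsets-complete (drop-∷-⊆ F⊆U) ∣F∣≡0)
kSubsets-complete {k = suc k} {outside ∷ F} {inside ∷ U} F⊆U ∣F∣≡k =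
  ∈-++⁺ʳ (map (inside ∷_) (kSubsets U k)) (∈-map⁺ (outside ∷_) (kSubsets-complete (drop-∷-⊆ F⊆U) ∣F∣≡k))

family-bound : ∀ (U : Subset n) {𝓕} → Unique 𝓕 → All (_⊆ U) 𝓕 → All (λ F → ∣ F ∣ ≡ k) 𝓕 →
               length 𝓕 ≤ ∣ U ∣ C k
family-bound {k = k} U {𝓕} u 𝓕⊆U sizes =
  subst (length 𝓕 ≤_) (length-kSubsets U k)
        (unique⇒length≤ u (All.zipWith (uncurry kSubsets-complete) (𝓕⊆U , sizes)))

⋃-upper : ∀ {F : Subset n} {L} → F ∈ L → F ⊆ ⋃ L
⋃-upper {L = G ∷ L} (here refl)  = p⊆p∪q (⋃ L)
⋃-upper {L = G ∷ L} (there F∈L) = ⊆-trans (⋃-upper F∈L) (q⊆p∪q G (⋃ L))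

⋃-least : ∀ {V : Subset n} {L} → All (_⊆ V) L → ⋃ L ⊆ V
⋃-least []                       = ⊥⊆
⋃-least {L = G ∷ L} (G⊆V ∷ L⊆V) x∈ = [ G⊆V , ⋃-least L⊆V ]′ (x∈p∪q⁻ G (⋃ L) x∈)

union-grows : ∀ {F V : Subset n} → F ⊈ V → ∣ V ∣ < ∣ F ∪ V ∣
union-grows {F = F} {V} F⊈V with V ⊂? F ∪ V
... | yes V⊂F∪V = p⊂q⇒∣p∣<∣q∣ V⊂F∪V
... | no  V⊄F∪V = ⊥-elim (F⊈V F⊆V)
  where
    F⊆V : F ⊆ V
    F⊆V {x} x∈F = decidable-stable (x ∈? V)
      (λ x∉V → V⊄F∪V (q⊆p∪q F V , x , p⊆p∪q V x∈F , x∉V))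

cover-or-grow : ∀ (𝓕 G : List (Subset n)) →
  All (_⊆ ⋃ G) 𝓕 ⊎ ∃ λ F → F ∈ 𝓕 × ∣ ⋃ G ∣ < ∣ ⋃ (F ∷ G) ∣
cover-or-grow 𝓕 G with all? (_⊆? ⋃ G) 𝓕
... | yes covered = inj₁ covered
... | no notCovered =
  let F , F∈𝓕 , F⊈⋃G = find (All.¬All⇒Any¬ (_⊆? ⋃ G) 𝓕 notCovered)
  in  inj₂ (F , F∈𝓕 , union-grows F⊈⋃G)

greedy-cover : ∀ (𝓕 : List (Subset n)) {F₀} → F₀ ∈ 𝓕 → ∀ t →
  ∃ λ G → All (_∈ 𝓕) G × length G ≤ suc t × (All (_⊆ ⋃ G) 𝓕 ⊎ ∣ F₀ ∣ + t ≤ ∣ ⋃ G ∣)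
greedy-cover 𝓕 {F₀} F₀∈𝓕 zero =
  [ F₀ ] , F₀∈𝓕 ∷ [] , ≤-refl ,
  inj₂ (subst (_≤ ∣ ⋃ [ F₀ ] ∣) (sym (+-identityʳ ∣ F₀ ∣)) (p⊆q⇒∣p∣≤∣q∣ (⋃-upper {L = [ F₀ ]} (here refl))))
greedy-cover 𝓕 {F₀} F₀∈𝓕 (suc t) with greedy-cover 𝓕 F₀∈𝓕 t
... | G , G⊆𝓕 , len , inj₁ covered = G , G⊆𝓕 , m≤n⇒m≤1+n len , inj₁ covered
... | G , G⊆𝓕 , len , inj₂ large with cover-or-grow 𝓕 G
...   | inj₁ covered = G , G⊆𝓕 , m≤n⇒m≤1+n len , inj₁ covered
...   | inj₂ (F , F∈𝓕 , grows) =
  F ∷ G , F∈𝓕 ∷ G⊆𝓕 , s≤s len , inj₂ (begin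
    ∣ F₀ ∣ + suc t    ≡⟨ +-suc ∣ F₀ ∣ t ⟩
    suc (∣ F₀ ∣ + t)  ≤⟨ s≤s large ⟩
    suc ∣ ⋃ G ∣       ≤⟨ grows ⟩
    ∣ ⋃ (F ∷ G) ∣     ∎)
  where open ≤-Reasoning

pad : Subset n → List (Subset n) → (s : ℕ) → Fin s → Subset n
pad d G s i = lookupOr d G (toℕ i)

pad-covers : ∀ (d : Subset n) G → length G ≤ s → ⋃ G ⊆ ⋃ (toList (pad d G s))
pad-covers {s = s} d G len = ⋃-least (All.tabulate entryCovered)
  where
    entryCovered : ∀ {F} → F ∈ G → F ⊆ ⋃ (toList (pad d G s))
    entryCovered {F} F∈G = subst (_⊆ ⋃ (toList (pad d G s))) (sym atPosition)
                             (⋃-upper (∈-tabulate⁺ (inject≤ (Any.index F∈G) len)))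
      where
        open ≡-Reasoning
        atPosition : F ≡ pad d G s (inject≤ (Any.index F∈G) len)
        atPosition = begin
          F                                                ≡⟨ lookup-index F∈G ⟩
          lookup G (Any.index F∈G)                         ≡⟨ lookupOr-lookup d G (Any.index F∈G) ⟨
          lookupOr d G (toℕ (Any.index F∈G))               ≡⟨ cong (lookupOr d G) (toℕ-inject≤ (Any.index F∈G) len) ⟨
          pad d G s (inject≤ (Any.index F∈G) len)          ∎

few-members-bound : ∀ {𝓕 G : List (Subset n)} {d} → PropU s q 𝓕 → d ∈ 𝓕 →
                    All (_∈ 𝓕) G → length G ≤ s → ∣ ⋃ G ∣ ≤ q
few-members-bound {s = s} {G = G} {d} U[s,q] d∈𝓕 G⊆𝓕 len =
  ≤-trans (p⊆q⇒∣p∣≤∣q∣ (pad-covers d G len))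
          (U[s,q] (pad d G s) (λ i → lookupOr-All d∈𝓕 G⊆𝓕 (toℕ i)))

union-bound : ∀ (𝓕 : List (Subset n)) → 2 ≤ s → q ≤ k + s ∸ 2 →
              All (λ F → ∣ F ∣ ≡ k) 𝓕 → PropU s q 𝓕 → ∣ ⋃ 𝓕 ∣ ≤ q
union-bound {n = n} {q = q} [] _ _ _ _ = subst (_≤ q) (sym (∣⊥∣≡0 n)) z≤n
union-bound {s = suc (suc r)} {q} {k} 𝓕@(F₀ ∷ _) (s≤s (s≤s _)) q≤k+s∸2 (∣F₀∣≡k ∷ _) U[s,q]
  with greedy-cover 𝓕 (here refl) (suc r)
... | G , G⊆𝓕 , len , inj₁ covered =
  ≤-trans (p⊆q⇒∣p∣≤∣q∣ (⋃-least covered)) (few-members-bound U[s,q] (here refl) G⊆𝓕 len)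
... | G , G⊆𝓕 , len , inj₂ large = contradiction
  (≤-trans (subst (λ m → m + suc r ≤ ∣ ⋃ G ∣) ∣F₀∣≡k large) (few-members-bound U[s,q] (here refl) G⊆𝓕 len))
  (<⇒≱ q<k+s-1)
  where
    open ≤-Reasoning
    q<k+s-1 : q < k + suc r
    q<k+s-1 = begin-strict
      q                      ≤⟨ q≤k+s∸2 ⟩
      k + suc (suc r) ∸ 2    ≡⟨ +-∸-assoc k (s≤s (s≤s (z≤n {r}))) ⟩
      k + r                  <⟨ +-monoʳ-< k (n<1+n r) ⟩
      k + suc r              ∎

upper-bound : ∀ (𝓕 : List (Subset n)) → 2 ≤ s → q ≤ k + s ∸ 2 →
              IsKFamily n k 𝓕 → PropU s q 𝓕 → length 𝓕 ≤ q C k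
upper-bound {q = q} {k} 𝓕 2≤s q≤k+s∸2 (unique , sizes) U[s,q] = begin
  length 𝓕       ≤⟨ family-bound (⋃ 𝓕) unique (All.tabulate ⋃-upper) sizes ⟩
  ∣ ⋃ 𝓕 ∣ C k    ≤⟨ C-monoˡ k (union-bound 𝓕 2≤s q≤k+s∸2 sizes U[s,q]) ⟩
  q C k          ∎
  where open ≤-Reasoning

subset-of-size : ∀ {n q} → q ≤ n → ∃ λ (U : Subset n) → ∣ U ∣ ≡ q
subset-of-size {zero}  z≤n = [] , refl
subset-of-size {suc n} z≤n with subset-of-size {n} z≤n
... | U , ∣U∣≡0 = outside ∷ U , ∣U∣≡0
subset-of-size {suc n} (s≤s q≤n) with subset-of-size q≤n
... | U , ∣U∣≡q = inside ∷ U , cong suc ∣U∣≡q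

extremal-family : ∀ (U : Subset n) → ∣ U ∣ ≡ q →
  IsKFamily n k (kSubsets U k) × PropU s q (kSubsets U k) × length (kSubsets U k) ≡ q C k
extremal-family {q = q} {k} {s} U ∣U∣≡q =
  (kSubsets-unique U k , All.map proj₂ (kSubsets-sound U k)) ,
  unionInsideU ,
  trans (length-kSubsets U k) (cong (_C k) ∣U∣≡q)
  where
    unionInsideU : PropU s q (kSubsets U k)
    unionInsideU F F∈ = ≤-trans
      (p⊆q⇒∣p∣≤∣q∣ (⋃-least (All.tabulate⁺ λ i → proj₁ (All.lookup (kSubsets-sound U k) (F∈ i)))))
      (≤-reflexive ∣U∣≡q)

-- The main theorem.
claim2 : (n k s q : ℕ) → 2 ≤ s → k ≤ q → q ≤ k + s ∸ 2 → q < n →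
    IsMaxU n k s q (q C k)
claim2 n k s q 2≤s _ q≤k+s∸2 q<n =
  let U , ∣U∣≡q = subset-of-size (<⇒≤ q<n)
  in  (kSubsets U k , extremal-family U ∣U∣≡q) ,
      λ 𝓕 isKFamily U[s,q] → upper-bound 𝓕 2≤s q≤k+s∸2 isKFamily U[s,q]
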